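{- For all integers $n\geq r\geq 1$, $$\left[ p_{n}^{(r)}\right]_{p,q}=\sum_{j=r}^{n}p_n^{(j)}\sum_{l=r}^{j}(-1)^{l-r}\binom{j}{l}\begin{bmatrix} l\\ r\end{bmatrix}_{p,q}.$$
   Context: Let $p,q$ be indeterminates and $\Lambda$ the ring of symmetric functions in infinitely many variables $x_1,x_2,\dots$ with coefficients in $\mathbb{Q}(p,q)$; $e_n$ are the elementary symmetric functions ($e_0=1$), $E(t)=\sum_{n\geq0}e_nt^n$, and $m_\lambda$ the monomial symmetric functions. For $n\geq r\geq 1$, $p_n^{(r)}=\sum m_\lambda$ over all partitions $\lambda$ of $n$ with exactly $r$ parts. Define $[n]_{p,q}=\frac{p^n-q^n}{p-q}=p^{n-1}+p^{n-2}q+\dots+q^{n-1}$, $[n]_{p,q}!=[1]_{p,q}\cdots[n]_{p,q}$ ($[0]_{p,q}!=1$), $\begin{bmatrix} n\\ k\end{bmatrix}_{p,q}=\frac{[n]_{p,q}!}{[k]_{p,q}![n-k]_{p,q}!}$ for $n\geq k\geq0$, and $D_{p,q}F(t)=\frac{F(pt)-F(qt)}{(p-q)t}$, $D_{p,q}^0F=F$, $D_{p,q}^r=D_{p,q}\circ D_{p,q}^{r-1}$. The elements $\left[ p_{n}^{(r)}\right]_{p,q}$ ($n\geq r\geq0$) are defined by $\sum_{n\geq r}\left[ p_{n}^{(r)}\right]_{p,q}(-t)^{n-r}=\frac{1}{[r]_{p,q}!}\frac{D_{p,q}^rE(t)}{E(t)}$. -}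

module Defs where

open import Level using (Level; _⊔_) renaming (suc to lsuc)
open import Algebra.Bundles using (CommutativeRing)
open import Data.Nat as ℕ using (ℕ; zero; suc; _∸_; _≤ᵇ_)
open import Data.Nat.Combinatorics using (_C_)
open import Data.Integer as ℤ using (ℤ; +_; -[1+_])
open import Data.Fin using (Fin)
open import Data.Product using (Σ; _×_; _,_)
open import Data.List as List using (List; []; _∷_; upTo; concatMap; foldr; map; filter; zipWith)
open import Data.List.Properties using (≡-dec)
open import Data.Vec as Vec using (Vec; []; _∷_)
open import Data.Bool using (Bool; true; false; if_then_else_; _∧_)
open import Relation.Nullary using (¬_; does; ¬?)
open import Relation.Binary.PropositionalEquality using (_≡_)
import Data.Nat.Properties as ℕP

record Field (c ℓ : Level) : Set (lsuc (c ⊔ ℓ)) where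
  field
    commutativeRing : CommutativeRing c ℓ
  open CommutativeRing commutativeRing public
  field
    _⁻¹      : Carrier → Carrier
    ⁻¹-cong  : ∀ {x y} → x ≈ y → (x ⁻¹) ≈ (y ⁻¹)
    inverse  : ∀ x → ¬ (x ≈ 0#) → (x * (x ⁻¹)) ≈ 1#
    1≉0      : ¬ (1# ≈ 0#)

module _ {c ℓ} (F : Field c ℓ) where
  open Field F

  ringSum : List Carrier → Carrier
  ringSum = foldr _+_ 0#

  natCast : ℕ → Carrier
  natCast zero    = 0#
  natCast (suc n) = 1# + natCast n

  intCast : ℤ → Carrier
  intCast (+ n)      = natCast n
  intCast -[1+ n ]   = - natCast (suc n)

  pow : Carrier → ℕ → Carrier
  pow x zero    = 1#
  pow x (suc n) = x * pow x n

  sign : ℕ → Carrier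
  sign k = pow (- 1#) k

  -- p and q are algebraically independent over ℤ (so the subfield of F
  -- they generate is ℚ(p,q), p,q indeterminates): every polynomial
  -- Σ_{i,j<d} c_{ij} X^i Y^j with integer coefficients, not all zero,
  -- does not vanish at (p,q).
  evalPoly2 : (d : ℕ) → (Fin d → Fin d → ℤ) → Carrier → Carrier → Carrier
  evalPoly2 d coef x y =
    ringSum (List.map (λ i → ringSum (List.map (λ j →
      intCast (coef i j) * (pow x (Data.Fin.toℕ i) * pow y (Data.Fin.toℕ j)))
      (List.allFin d))) (List.allFin d))

  AlgIndep : Carrier → Carrier → Set ℓ
  AlgIndep x y = ∀ (d : ℕ) (coef : Fin d → Fin d → ℤ) →
    Σ (Fin d) (λ i → Σ (Fin d) (λ j → ¬ (coef i j ≡ + 0))) →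
    ¬ (evalPoly2 d coef x y ≈ 0#)

rangeList : ℕ → ℕ → List ℕ
rangeList a b = List.map (a ℕ.+_) (upTo (suc b ∸ a))

-- Partitions with exactly r parts, as weakly decreasing lists of
-- positive integers.

partsB : ℕ → ℕ → ℕ → List (List ℕ)
partsB zero    zero    m = [] ∷ []
partsB zero    (suc n) m = []
partsB (suc r) n       m =
  concatMap (λ k → List.map (k ∷_) (partsB r (n ∸ k) k))
            (rangeList 1 (ℕ._⊓_ n m))

partitions : ℕ → ℕ → List (List ℕ)
partitions n r = partsB r n n

insertDesc : ℕ → List ℕ → List ℕ
insertDesc x []       = x ∷ []
insertDesc x (y ∷ ys) = if y ≤ᵇ x then x ∷ y ∷ ys else y ∷ insertDesc x ys

sortDesc : List ℕ → List ℕ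
sortDesc = foldr insertDesc []

allB : {A : Set} → (A → Bool) → List A → Bool
allB P = foldr (λ a b → P a ∧ b) true

isNonzero : ℕ → Bool
isNonzero zero    = false
isNonzero (suc _) = true

-- Formal power series in infinitely many variables x₁, x₂, … over F.
-- A monomial x^α is represented by its exponent vector α : List ℕ
-- (entry i = exponent of x_{i+1}; missing trailing entries are 0).
-- A series is its coefficient function; all series below give the same
-- coefficient to lists differing by trailing zeros.

Mon : Set
Mon = List ℕ

splits : Mon → List (Mon × Mon)
splits []      = ([] , []) ∷ []
splits (a ∷ α) =
  concatMap (λ k → List.map (λ { (β , γ) → (k ∷ β , (a ∸ k) ∷ γ) }) (splits α))
            (upTo (suc a))

module Sym {c ℓ} (F : Field c ℓ) (p q : Field.Carrier F) where
  open Field F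

  Series : Set c
  Series = Mon → Carrier

  _≈ₛ_ : Series → Series → Set ℓ
  f ≈ₛ g = ∀ α → f α ≈ g α

  boolCoeff : Bool → Carrier
  boolCoeff true  = 1#
  boolCoeff false = 0#

  0ₛ : Series
  0ₛ _ = 0#

  1ₛ : Series
  1ₛ α = boolCoeff (allB (λ a → ℕ._≡ᵇ_ a 0) α)

  _+ₛ_ : Series → Series → Series
  (f +ₛ g) α = f α + g α

  -ₛ_ : Series → Series
  (-ₛ f) α = - f α

  _·ₛ_ : Carrier → Series → Series
  (k ·ₛ f) α = k * f α

  _*ₛ_ : Series → Series → Series
  (f *ₛ g) α = ringSum F (List.map (λ { (β , γ) → f β * g γ }) (splits α))

  sumₛ : List Series → Series
  sumₛ = foldr _+ₛ_ 0ₛ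

  e : ℕ → Series
  e n α = boolCoeff (allB (λ a → a ≤ᵇ 1) α ∧ ℕ._≡ᵇ_ (foldr ℕ._+_ 0 α) n)

  m : List ℕ → Series
  m lam α = boolCoeff (does (≡-dec ℕ._≟_ (sortDesc (filter (λ a → ¬? (a ℕ.≟ 0)) α)) lam))

  pnr : ℕ → ℕ → Series
  pnr n r = sumₛ (List.map m (partitions n r))

  -- Formal power series in t with coefficients in the series above
  PS : Set c
  PS = ℕ → Series

  E : PS
  E = e

  _-ₚ_ : PS → PS → PS
  (A -ₚ B) n = A n +ₛ (-ₛ B n)

  _·ₚ_ : Carrier → PS → PS
  (k ·ₚ A) n = k ·ₛ A n

  dil : Carrier → PS → PS
  dil k A n = pow F k n ·ₛ A n

  -- division by t (applied to series with zero constant term)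
  divT : PS → PS
  divT A n = A (suc n)

  _*ₚ_ : PS → PS → PS
  (A *ₚ B) n = sumₛ (List.map (λ k → A k *ₛ B (n ∸ k)) (upTo (suc n)))

  -- multiplicative inverse of a power series A with A(0) = 1:
  -- g₀ = 1, g_n = - Σ_{k=1}^{n} A_k g_{n-k};  invVec A n = g_n ∷ … ∷ g₀
  invVec : PS → (n : ℕ) → Vec Series (suc n)
  invVec A zero    = 1ₛ ∷ []
  invVec A (suc n) =
    (-ₛ sumₛ (Vec.toList (Vec.zipWith (λ k g → A k *ₛ g)
                                       (Vec.map (λ i → suc (Data.Fin.toℕ i)) (Vec.allFin (suc n)))
                                       (invVec A n))))
    ∷ invVec A n

  inv : PS → PS
  inv A n = Vec.head (invVec A n)

  D : PS → PS
  D A = ((p - q) ⁻¹) ·ₚ divT (dil p A -ₚ dil q A)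

  Dpow : ℕ → PS → PS
  Dpow zero    A = A
  Dpow (suc r) A = D (Dpow r A)

  qn : ℕ → Carrier
  qn n = (pow F p n - pow F q n) * ((p - q) ⁻¹)

  qfact : ℕ → Carrier
  qfact zero    = 1#
  qfact (suc n) = qfact n * qn (suc n)

  qbinom : ℕ → ℕ → Carrier
  qbinom n k = qfact n * ((qfact k * qfact (n ∸ k)) ⁻¹)

  -- Σ_{n≥r} [p_n^{(r)}] (-t)^{n-r} = (1/[r]!) D^r E(t) / E(t)
  genR : ℕ → PS
  genR r = (qfact r ⁻¹) ·ₚ (Dpow r E *ₚ inv E)

  -- [p_n^{(r)}]_{p,q}  (for n ≥ r): (-1)^{n-r} times coefficient of t^{n-r}
  bracketP : ℕ → ℕ → Series
  bracketP n r = sign F (n ∸ r) ·ₛ genR r (n ∸ r)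

  rhs : ℕ → ℕ → Series
  rhs n r = sumₛ (List.map (λ j →
      ringSum F (List.map (λ l → sign F (l ∸ r) * (natCast F (j C l) * qbinom l r))
                          (rangeList r j))
      ·ₛ pnr n j)
    (rangeList r n))

module Submission where

-- Both sides are compared coefficientwise at a monomial x^α, where every coefficient involved
-- depends only on the degree d of x^α and the number s of variables occurring in it.  Writing
-- h_l for the sum of all monomials of degree l, e_k h_l has coefficient [d = k + l] (s choose k)
-- at x^α; together with Σ_{i≤n} (-1)^(n-i) (s choose i+1) = (-1)^n for 1 ≤ s ≤ n + 1 this shows
-- E(t)⁻¹ = Σ_m (-1)^m h_m t^m.  As D_{p,q} t^m = [m]_{p,q} t^(m-1), the coefficient of t^k in
-- D^r E is [k+1]⋯[k+r] e_{r+k}, and [k+1]⋯[k+r] / [r]! = [r+k choose r]_{p,q}; this division is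
-- where algebraic independence of p and q enters, making the (p,q)-integers nonzero.  Hence the
-- left side has coefficient [d = n] Σ_i (-1)^i [r+i choose r]_{p,q} (s choose r+i) at x^α.  On the
-- right p_n^{(j)} has coefficient [d = n, s = j], so only j = s contributes, and its coefficient
-- is the same alternating sum because (s choose r+i) = 0 once r + i > s.

open import Defs
open import Data.Nat using (ℕ; _≤_)

open import Algebra.Bundles using (Semiring)
open import Data.Bool using (Bool; true; false; _∧_; T; if_then_else_)
open import Data.Bool.Properties using (T-∧)
open import Data.Empty using (⊥-elim)
open import Data.Fin as Fin using (Fin; toℕ)
import Data.Fin.Properties as Fin
open import Data.Integer using (ℤ; +_; -[1+_])
open import Data.List as List
  using (List; []; _∷_; _++_; map; foldr; concatMap; applyUpTo; upTo; filter; length)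
import Data.List.Properties as List
open import Data.List.Properties using (≡-dec)
open import Data.List.Relation.Binary.Permutation.Propositional using (_↭_; ↭-sym)
open import Data.List.Relation.Binary.Permutation.Propositional.Properties using (↭-length; All-resp-↭)
open import Data.List.Relation.Unary.All using (All; []; _∷_)
open import Data.List.Relation.Unary.All.Properties using (all-filter)
open import Data.List.Relation.Unary.Linked using (Linked; []; [-]; _∷_)
open import Data.Maybe using (nothing)
open import Data.Nat as ℕ using (zero; suc; _∸_; _<_; _≥_; _⊓_; _≡ᵇ_; _≤ᵇ_; _<ᵇ_; z≤n; s≤s)
open import Data.Nat.Combinatorics using (_C_; k>n⇒nCk≡0; nCk+nC[k+1]≡[n+1]C[k+1])
import Data.Nat.ListAction as ℕₗ
import Data.Nat.ListAction.Properties as ℕₗ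
import Data.Nat.Properties as ℕₚ
open import Data.Product using (_×_; _,_)
open import Data.Vec as Vec using (Vec; []; _∷_)
import Data.Vec.Properties as Vec
open import Function using (_∘_; id)
open import Function.Bundles using (Equivalence)
open import Relation.Binary.Properties.DecTotalOrder ℕₚ.≤-decTotalOrder using (≥-decTotalOrder)
open import Data.List.Sort.InsertionSort.Base ≥-decTotalOrder using (insert; sort)
import Data.List.Sort.InsertionSort.Properties ≥-decTotalOrder as Sort
open import Relation.Binary.PropositionalEquality as ≡ using (_≡_; _≢_)
open import Relation.Nullary using (¬_; ¬?; yes; no; does)
open import Algebra.Properties.CommutativeSemigroup ℕₚ.+-commutativeSemigroup
  using () renaming (interchange to ℕ-interchange)
open import Tactic.RingSolver.Core.AlmostCommutativeRing using (fromCommutativeRing)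
import Tactic.RingSolver.NonReflective

≡ᵇ-refl : ∀ n → (n ≡ᵇ n) ≡ true
≡ᵇ-refl zero    = ≡.refl
≡ᵇ-refl (suc n) = ≡ᵇ-refl n

≢⇒≡ᵇ-false : ∀ {m n} → m ≢ n → (m ≡ᵇ n) ≡ false
≢⇒≡ᵇ-false {zero}  {zero}  m≢n = ⊥-elim (m≢n ≡.refl)
≢⇒≡ᵇ-false {zero}  {suc n} m≢n = ≡.refl
≢⇒≡ᵇ-false {suc m} {zero}  m≢n = ≡.refl
≢⇒≡ᵇ-false {suc m} {suc n} m≢n = ≢⇒≡ᵇ-false (m≢n ∘ ≡.cong suc)

+-≡ᵇ : ∀ k m n → (k ℕ.+ m ≡ᵇ k ℕ.+ n) ≡ (m ≡ᵇ n)
+-≡ᵇ zero    m n = ≡.refl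
+-≡ᵇ (suc k) m n = +-≡ᵇ k m n

T-ext : ∀ {a b} → (T a → T b) → (T b → T a) → a ≡ b
T-ext {false} {false} _   _   = ≡.refl
T-ext {false} {true}  _   b⇒a = ⊥-elim (b⇒a _)
T-ext {true}  {false} a⇒b _   = ⊥-elim (a⇒b _)
T-ext {true}  {true}  _   _   = ≡.refl

module SemiringSums {c ℓ} (R : Semiring c ℓ) where
  open Semiring R
  open import Relation.Binary.Reasoning.Setoid setoid

  sum : List Carrier → Carrier
  sum = foldr _+_ 0#

  ∑< : ℕ → (ℕ → Carrier) → Carrier
  ∑< n f = sum (applyUpTo f n)

  syntax ∑< n (λ i → x) = ∑[ i < n ] x

  module _ {a} {A : Set a} where

    sum-map-cong : {f g : A → Carrier} (xs : List A) → (∀ x → f x ≈ g x) →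
                   sum (map f xs) ≈ sum (map g xs)
    sum-map-cong []       f≈g = refl
    sum-map-cong (x ∷ xs) f≈g = +-cong (f≈g x) (sum-map-cong xs f≈g)

    sum-map-zero : {f : A → Carrier} (xs : List A) → (∀ x → f x ≈ 0#) → sum (map f xs) ≈ 0#
    sum-map-zero []       f≈0 = refl
    sum-map-zero (x ∷ xs) f≈0 = trans (+-cong (f≈0 x) (sum-map-zero xs f≈0)) (+-identityˡ 0#)

    *-distribˡ-sum-map : ∀ k (f : A → Carrier) xs →
                         k * sum (map f xs) ≈ sum (map (λ x → k * f x) xs)
    *-distribˡ-sum-map k f []       = zeroʳ k
    *-distribˡ-sum-map k f (x ∷ xs) = trans (distribˡ k _ _) (+-cong refl (*-distribˡ-sum-map k f xs))

  sum-++ : ∀ xs ys → sum (xs ++ ys) ≈ sum xs + sum ys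
  sum-++ []       ys = sym (+-identityˡ _)
  sum-++ (x ∷ xs) ys = trans (+-cong refl (sum-++ xs ys)) (sym (+-assoc _ _ _))

  sum-map-concatMap : ∀ {a b} {A : Set a} {B : Set b} (f : B → Carrier) (G : A → List B) xs →
                      sum (map f (concatMap G xs)) ≈ sum (map (λ x → sum (map f (G x))) xs)
  sum-map-concatMap f G []       = refl
  sum-map-concatMap f G (x ∷ xs) = begin
    sum (map f (G x ++ concatMap G xs))               ≡⟨ ≡.cong sum (List.map-++ f (G x) _) ⟩
    sum (map f (G x) ++ map f (concatMap G xs))       ≈⟨ sum-++ (map f (G x)) _ ⟩
    sum (map f (G x)) + sum (map f (concatMap G xs))  ≈⟨ +-cong refl (sum-map-concatMap f G xs) ⟩
    sum (map (λ x → sum (map f (G x))) (x ∷ xs))      ∎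

  sum-map-upTo : ∀ (f : ℕ → Carrier) n → sum (map f (upTo n)) ≡ ∑[ i < n ] f i
  sum-map-upTo f n = ≡.cong sum (List.map-upTo f n)

  sum-map-rangeList : ∀ (f : ℕ → Carrier) a b →
                      sum (map f (rangeList a b)) ≡ ∑[ i < suc b ∸ a ] f (a ℕ.+ i)
  sum-map-rangeList f a b =
    ≡.cong sum (≡.trans (≡.sym (List.map-∘ (upTo (suc b ∸ a)))) (List.map-upTo _ (suc b ∸ a)))

  ∑<-cong : ∀ n {f g : ℕ → Carrier} → (∀ i → i < n → f i ≈ g i) → ∑< n f ≈ ∑< n g
  ∑<-cong zero    f≈g = refl
  ∑<-cong (suc n) f≈g = +-cong (f≈g 0 (s≤s z≤n)) (∑<-cong n (λ i i<n → f≈g (suc i) (s≤s i<n)))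

  ∑<-zero : ∀ n {f : ℕ → Carrier} → (∀ i → i < n → f i ≈ 0#) → ∑< n f ≈ 0#
  ∑<-zero zero    f≈0 = refl
  ∑<-zero (suc n) f≈0 =
    trans (+-cong (f≈0 0 (s≤s z≤n)) (∑<-zero n (λ i i<n → f≈0 (suc i) (s≤s i<n)))) (+-identityˡ 0#)

  ∑<-single : ∀ n {x} {f : ℕ → Carrier} → x < n → (∀ i → i < n → i ≢ x → f i ≈ 0#) →
              ∑< n f ≈ f x
  ∑<-single (suc n) {zero} x<n f≈0 =
    trans (+-cong refl (∑<-zero n (λ i i<n → f≈0 (suc i) (s≤s i<n) λ ()))) (+-identityʳ _)
  ∑<-single (suc n) {suc x} (s≤s x<n) f≈0 =
    trans (+-cong (f≈0 0 (s≤s z≤n) λ ())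
                  (∑<-single n x<n (λ i i<n i≢x → f≈0 (suc i) (s≤s i<n) (i≢x ∘ ℕₚ.suc-injective))))
          (+-identityˡ _)

  *-distribˡ-∑< : ∀ k n (f : ℕ → Carrier) → k * ∑< n f ≈ ∑[ i < n ] (k * f i)
  *-distribˡ-∑< k zero    f = zeroʳ k
  *-distribˡ-∑< k (suc n) f = trans (distribˡ k _ _) (+-cong refl (*-distribˡ-∑< k n (f ∘ suc)))

  ∑<-+ : ∀ m n (f : ℕ → Carrier) → ∑< (m ℕ.+ n) f ≈ ∑< m f + ∑[ i < n ] f (m ℕ.+ i)
  ∑<-+ zero    n f = sym (+-identityˡ _)
  ∑<-+ (suc m) n f = trans (+-cong refl (∑<-+ m n (f ∘ suc))) (sym (+-assoc _ _ _))

  ∑<-suc : ∀ n (f : ℕ → Carrier) → ∑< (suc n) f ≈ ∑< n f + f n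
  ∑<-suc n f = begin
    ∑< (suc n) f                  ≡⟨ ≡.cong (λ m → ∑< m f) (ℕₚ.+-comm 1 n) ⟩
    ∑< (n ℕ.+ 1) f                ≈⟨ ∑<-+ n 1 f ⟩
    ∑< n f + (f (n ℕ.+ 0) + 0#)   ≈⟨ +-cong refl (+-identityʳ _) ⟩
    ∑< n f + f (n ℕ.+ 0)          ≡⟨ ≡.cong (λ m → ∑< n f + f m) (ℕₚ.+-identityʳ n) ⟩
    ∑< n f + f n                  ∎

module FieldProperties {c ℓ} (F : Field c ℓ) where
  open Field F
  open import Relation.Binary.Reasoning.Setoid setoid
  open import Algebra.Properties.Ring ring using (-1*x≈-x; -‿involutive; -‿+-comm)
  open import Algebra.Properties.CommutativeSemigroup *-commutativeSemigroup using (interchange)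
  open SemiringSums semiring

  module Solver = Tactic.RingSolver.NonReflective (fromCommutativeRing commutativeRing (λ _ → nothing))

  x*y≈1⇒x≉0 : ∀ {x y} → x * y ≈ 1# → ¬ x ≈ 0#
  x*y≈1⇒x≉0 {x} {y} xy≈1 x≈0 = 1≉0 (begin
    1#      ≈⟨ xy≈1 ⟨
    x * y   ≈⟨ *-cong x≈0 refl ⟩
    0# * y  ≈⟨ zeroˡ y ⟩
    0#      ∎)

  ⁻¹-unique : ∀ {x y} → x * y ≈ 1# → y ≈ x ⁻¹
  ⁻¹-unique {x} {y} xy≈1 = begin
    y               ≈⟨ *-identityʳ y ⟨
    y * 1#          ≈⟨ *-cong refl (inverse x (x*y≈1⇒x≉0 xy≈1)) ⟨
    y * (x * x ⁻¹)  ≈⟨ *-assoc y x (x ⁻¹) ⟨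
    (y * x) * x ⁻¹  ≈⟨ *-cong (trans (*-comm y x) xy≈1) refl ⟩
    1# * x ⁻¹       ≈⟨ *-identityˡ (x ⁻¹) ⟩
    x ⁻¹            ∎

  ⁻¹-nonzero : ∀ {x} → ¬ x ≈ 0# → ¬ x ⁻¹ ≈ 0#
  ⁻¹-nonzero {x} x≉0 = x*y≈1⇒x≉0 (trans (*-comm (x ⁻¹) x) (inverse x x≉0))

  *-inverses : ∀ {x y} → ¬ x ≈ 0# → ¬ y ≈ 0# → (x * y) * (x ⁻¹ * y ⁻¹) ≈ 1#
  *-inverses {x} {y} x≉0 y≉0 = begin
    (x * y) * (x ⁻¹ * y ⁻¹)  ≈⟨ interchange x y (x ⁻¹) (y ⁻¹) ⟩
    (x * x ⁻¹) * (y * y ⁻¹)  ≈⟨ *-cong (inverse x x≉0) (inverse y y≉0) ⟩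
    1# * 1#                  ≈⟨ *-identityʳ 1# ⟩
    1#                       ∎

  *-nonzero : ∀ {x y} → ¬ x ≈ 0# → ¬ y ≈ 0# → ¬ x * y ≈ 0#
  *-nonzero x≉0 y≉0 = x*y≈1⇒x≉0 (*-inverses x≉0 y≉0)

  ⁻¹-distrib-* : ∀ {x y} → ¬ x ≈ 0# → ¬ y ≈ 0# → (x * y) ⁻¹ ≈ x ⁻¹ * y ⁻¹
  ⁻¹-distrib-* x≉0 y≉0 = sym (⁻¹-unique (*-inverses x≉0 y≉0))

  natCast-+ : ∀ m n → natCast F (m ℕ.+ n) ≈ natCast F m + natCast F n
  natCast-+ zero    n = sym (+-identityˡ _)
  natCast-+ (suc m) n = trans (+-cong refl (natCast-+ m n)) (sym (+-assoc _ _ _))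

  sign-suc : ∀ n → sign F (suc n) ≈ - sign F n
  sign-suc n = -1*x≈-x (sign F n)

  sign-+ : ∀ m n → sign F (m ℕ.+ n) ≈ sign F m * sign F n
  sign-+ zero    n = sym (*-identityˡ _)
  sign-+ (suc m) n = trans (*-cong refl (sign-+ m n)) (sym (*-assoc _ _ _))

  sign-square : ∀ n → sign F n * sign F n ≈ 1#
  sign-square zero    = *-identityʳ 1#
  sign-square (suc n) = begin
    (- 1# * sign F n) * (- 1# * sign F n)  ≈⟨ interchange (- 1#) (sign F n) (- 1#) (sign F n) ⟩
    (- 1# * - 1#) * (sign F n * sign F n)  ≈⟨ *-cong (trans (-1*x≈-x (- 1#)) (-‿involutive 1#)) (sign-square n) ⟩
    1# * 1#                                ≈⟨ *-identityʳ 1# ⟩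
    1#                                     ∎

  sign-∸ : ∀ {i k} → i ≤ k → sign F k * sign F (k ∸ i) ≈ sign F i
  sign-∸ {i} {k} i≤k = begin
    sign F k * sign F (k ∸ i)                     ≡⟨ ≡.cong (λ t → sign F t * sign F (k ∸ i)) (ℕₚ.m+[n∸m]≡n i≤k) ⟨
    sign F (i ℕ.+ (k ∸ i)) * sign F (k ∸ i)       ≈⟨ *-cong (sign-+ i (k ∸ i)) refl ⟩
    (sign F i * sign F (k ∸ i)) * sign F (k ∸ i)  ≈⟨ *-assoc _ _ _ ⟩
    sign F i * (sign F (k ∸ i) * sign F (k ∸ i))  ≈⟨ *-cong refl (sign-square (k ∸ i)) ⟩
    sign F i * 1#                                 ≈⟨ *-identityʳ _ ⟩
    sign F i                                      ∎

  alternating-binomial : ∀ n s →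
    ∑[ i < suc n ] (sign F (n ∸ i) * natCast F (suc s C suc i)) ≈ natCast F (s C suc n) + sign F n
  alternating-binomial zero s = begin
    1# * natCast F (suc s C 1) + 0#        ≈⟨ trans (+-identityʳ _) (*-identityˡ _) ⟩
    natCast F (suc s C 1)                  ≡⟨ ≡.cong (natCast F) (nCk+nC[k+1]≡[n+1]C[k+1] s 0) ⟨
    natCast F (s C 0 ℕ.+ s C 1)            ≈⟨ natCast-+ (s C 0) (s C 1) ⟩
    natCast F (s C 0) + natCast F (s C 1)  ≈⟨ +-comm _ _ ⟩
    natCast F (s C 1) + (1# + 0#)          ≈⟨ +-cong refl (+-identityʳ 1#) ⟩
    natCast F (s C 1) + 1#                 ∎
  alternating-binomial (suc n) s = begin
    ∑< (suc (suc n)) term′                       ≈⟨ ∑<-suc (suc n) term′ ⟩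
    ∑< (suc n) term′ + term′ (suc n)             ≈⟨ +-cong (∑<-cong (suc n) sign-shift) last-term ⟩
    ∑[ i < suc n ] (- 1# * term i) + natCast F (suc s C suc (suc n))
      ≈⟨ +-cong (*-distribˡ-∑< (- 1#) (suc n) term) refl ⟨
    - 1# * ∑< (suc n) term + natCast F (suc s C suc (suc n))
      ≈⟨ +-cong (-1*x≈-x _) (reflexive (≡.cong (natCast F) (≡.sym (nCk+nC[k+1]≡[n+1]C[k+1] s (suc n))))) ⟩
    - ∑< (suc n) term + natCast F (s C suc n ℕ.+ s C suc (suc n))
      ≈⟨ +-cong (-‿cong (alternating-binomial n s)) (natCast-+ (s C suc n) (s C suc (suc n))) ⟩
    - (a + sign F n) + (a + b)                   ≈⟨ +-cong (-‿+-comm a (sign F n)) refl ⟨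
    (- a + - sign F n) + (a + b)
      ≈⟨ Solver.solve 4 (λ x y a b → ((x ⊕ y) ⊕ (a ⊕ b)) ⊜ ((x ⊕ a) ⊕ (b ⊕ y))) refl (- a) (- sign F n) a b ⟩
    (- a + a) + (b + - sign F n)                 ≈⟨ +-cong (-‿inverseˡ a) refl ⟩
    0# + (b + - sign F n)                        ≈⟨ +-identityˡ _ ⟩
    b + - sign F n                               ≈⟨ +-cong refl (sign-suc n) ⟨
    b + sign F (suc n)                           ∎
    where
    open Solver
    term term′ : ℕ → Carrier
    term  i = sign F (n ∸ i) * natCast F (suc s C suc i)
    term′ i = sign F (suc n ∸ i) * natCast F (suc s C suc i)
    a = natCast F (s C suc n)
    b = natCast F (s C suc (suc n))
    sign-shift : ∀ i → i < suc n → term′ i ≈ - 1# * term i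
    sign-shift i (s≤s i≤n) rewrite ℕₚ.+-∸-assoc 1 i≤n = *-assoc _ _ _
    last-term : term′ (suc n) ≈ natCast F (suc s C suc (suc n))
    last-term rewrite ℕₚ.n∸n≡0 n = *-identityˡ _

  alternating-binomial-sign : ∀ n s → 1 ≤ s → s ≤ suc n →
    ∑[ i < suc n ] (sign F (n ∸ i) * natCast F (s C suc i)) ≈ sign F n
  alternating-binomial-sign n (suc s) _ (s≤s s≤n) = begin
    _                                 ≈⟨ alternating-binomial n s ⟩
    natCast F (s C suc n) + sign F n  ≡⟨ ≡.cong (λ m → natCast F m + sign F n) (k>n⇒nCk≡0 (s≤s s≤n)) ⟩
    0# + sign F n                     ≈⟨ +-identityˡ _ ⟩
    sign F n                          ∎

module PowerDifference {c ℓ} (F : Field c ℓ) where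
  open Field F
  open import Relation.Binary.Reasoning.Setoid setoid
  open import Algebra.Properties.Ring ring using (-1*x≈-x)
  open SemiringSums semiring

  -- The coefficient of X^a Y^b in X^(k+1) − Y^(k+1).
  powDiffCoeff : ℕ → ℕ → ℕ → ℤ
  powDiffCoeff k zero    b       = if b ≡ᵇ suc k then -[1+ 0 ] else + 0
  powDiffCoeff k (suc a) zero    = if a ≡ᵇ k then + 1 else + 0
  powDiffCoeff k (suc a) (suc b) = + 0

  sum-map-allFin : ∀ d (f : ℕ → Carrier) → sum (map (f ∘ toℕ) (List.allFin d)) ≡ ∑< d f
  sum-map-allFin d f = ≡.cong sum (≡.trans (List.map-tabulate {n = d} id (f ∘ toℕ)) (tabulate-toℕ d f))
    where
    tabulate-toℕ : ∀ d (f : ℕ → Carrier) → List.tabulate {n = d} (f ∘ toℕ) ≡ applyUpTo f d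
    tabulate-toℕ zero    f = ≡.refl
    tabulate-toℕ (suc d) f = ≡.cong (f 0 ∷_) (tabulate-toℕ d (f ∘ suc))

  evalPoly2-∑ : ∀ d (coeff : ℕ → ℕ → ℤ) x y →
    evalPoly2 F d (λ i j → coeff (toℕ i) (toℕ j)) x y
      ≈ ∑[ a < d ] ∑[ b < d ] (intCast F (coeff a b) * (pow F x a * pow F y b))
  evalPoly2-∑ d coeff x y =
    trans (reflexive (sum-map-allFin d _)) (∑<-cong d (λ a _ → reflexive (sum-map-allFin d _)))

  evalPoly2-powDiff : ∀ k x y →
    evalPoly2 F (suc (suc k)) (λ i j → powDiffCoeff k (toℕ i) (toℕ j)) x y
      ≈ pow F x (suc k) - pow F y (suc k)
  evalPoly2-powDiff k x y = begin
    _                                     ≈⟨ evalPoly2-∑ (suc K) (powDiffCoeff k) x y ⟩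
    row 0 + ∑[ a < K ] row (suc a)        ≈⟨ +-cong row-zero (∑<-single K (ℕₚ.n<1+n k) off-k) ⟩
    - pow F y K + row (suc k)             ≈⟨ +-cong refl (row-suc k) ⟩
    - pow F y K + [a=k] k * pow F x K     ≡⟨ ≡.cong (λ t → - pow F y K + intCast F (if t then + 1 else + 0) * pow F x K)
                                                    (≡ᵇ-refl k) ⟩
    - pow F y K + (1# + 0#) * pow F x K   ≈⟨ +-cong refl (trans (*-cong (+-identityʳ 1#) refl) (*-identityˡ _)) ⟩
    - pow F y K + pow F x K               ≈⟨ +-comm _ _ ⟩
    pow F x K - pow F y K                 ∎
    where
    K = suc k
    term : ℕ → ℕ → Carrier
    term a b = intCast F (powDiffCoeff k a b) * (pow F x a * pow F y b)
    row : ℕ → Carrier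
    row a = ∑[ b < suc K ] term a b
    [a=k] : ℕ → Carrier
    [a=k] a = intCast F (if a ≡ᵇ k then + 1 else + 0)
    row-zero : row 0 ≈ - pow F y K
    row-zero = begin
      row 0                           ≈⟨ ∑<-single (suc K) (ℕₚ.n<1+n K) off-K ⟩
      term 0 K                        ≡⟨ ≡.cong (λ t → intCast F (if t then -[1+ 0 ] else + 0) * (1# * pow F y K))
                                                (≡ᵇ-refl k) ⟩
      - (1# + 0#) * (1# * pow F y K)  ≈⟨ *-cong (-‿cong (+-identityʳ 1#)) (*-identityˡ _) ⟩
      - 1# * pow F y K                ≈⟨ -1*x≈-x _ ⟩
      - pow F y K                     ∎
      where
      off-K : ∀ b → b < suc K → b ≢ K → term 0 b ≈ 0#
      off-K b _ b≢K rewrite ≢⇒≡ᵇ-false b≢K = zeroˡ _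
    row-suc : ∀ a → row (suc a) ≈ [a=k] a * pow F x (suc a)
    row-suc a = trans (+-cong refl (∑<-zero K (λ b _ → zeroˡ (pow F x (suc a) * pow F y (suc b)))))
                      (trans (+-identityʳ _) (*-cong refl (*-identityʳ _)))
    off-k : ∀ a → a < K → a ≢ k → row (suc a) ≈ 0#
    off-k a _ a≢k = begin
      row (suc a)                 ≈⟨ row-suc a ⟩
      [a=k] a * pow F x (suc a)   ≡⟨ ≡.cong (λ t → intCast F (if t then + 1 else + 0) * pow F x (suc a))
                                            (≢⇒≡ᵇ-false a≢k) ⟩
      0# * pow F x (suc a)        ≈⟨ zeroˡ _ ⟩
      0#                          ∎

degree : Mon → ℕ
degree = ℕₗ.sum

nonzeros : List ℕ → List ℕ
nonzeros = filter (λ a → ¬? (a ℕ.≟ 0))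

#support : Mon → ℕ
#support α = length (nonzeros α)

degree-nonzeros : ∀ α → degree (nonzeros α) ≡ degree α
degree-nonzeros []          = ≡.refl
degree-nonzeros (zero ∷ α)  = degree-nonzeros α
degree-nonzeros (suc a ∷ α) = ≡.cong (suc a ℕ.+_) (degree-nonzeros α)

#support≤degree : ∀ α → #support α ≤ degree α
#support≤degree []          = z≤n
#support≤degree (zero ∷ α)  = #support≤degree α
#support≤degree (suc a ∷ α) = s≤s (ℕₚ.≤-trans (#support≤degree α) (ℕₚ.m≤n+m (degree α) a))

1≤degree⇒1≤#support : ∀ α → 1 ≤ degree α → 1 ≤ #support α
1≤degree⇒1≤#support (zero ∷ α)  d≥1 = 1≤degree⇒1≤#support α d≥1
1≤degree⇒1≤#support (suc a ∷ α) _   = s≤s z≤n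

sortDesc≡sort : ∀ xs → sortDesc xs ≡ sort xs
sortDesc≡sort []       = ≡.refl
sortDesc≡sort (x ∷ xs) = ≡.trans (≡.cong (insertDesc x) (sortDesc≡sort xs)) (insertDesc≡insert (sort xs))
  where
  insertDesc≡insert : ∀ ys → insertDesc x ys ≡ insert x ys
  insertDesc≡insert []       = ≡.refl
  insertDesc≡insert (y ∷ ys) with y ≤ᵇ x
  ... | true  = ≡.refl
  ... | false = ≡.cong (y ∷_) (insertDesc≡insert ys)

sortDesc-↭ : ∀ xs → sortDesc xs ↭ xs
sortDesc-↭ xs = ≡.subst (_↭ xs) (≡.sym (sortDesc≡sort xs)) (Sort.sort-↭ xs)

sortDesc-decreasing : ∀ xs → Linked _≥_ (sortDesc xs)
sortDesc-decreasing xs = ≡.subst (Linked _≥_) (≡.sym (sortDesc≡sort xs)) (Sort.sort-↗ xs)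

Linked-≥-degree : ∀ {μ} → Linked _≥_ μ → Linked _≥_ (degree μ ∷ μ)
Linked-≥-degree {[]}    []   = [-]
Linked-≥-degree {x ∷ μ} link = ℕₚ.m≤m+n x (degree μ) ∷ link

partsBᵇ : ℕ → ℕ → ℕ → List ℕ → Bool
partsBᵇ zero    n m []          = n ≡ᵇ 0
partsBᵇ zero    n m (_ ∷ _)     = false
partsBᵇ (suc r) n m []          = false
partsBᵇ (suc r) n m (zero  ∷ μ) = false
partsBᵇ (suc r) n m (suc x ∷ μ) = (x <ᵇ n ⊓ m) ∧ partsBᵇ r (n ∸ suc x) (suc x) μ

partsBᵇ-sound : ∀ r n m μ → T (partsBᵇ r n m μ) → length μ ≡ r × degree μ ≡ n
partsBᵇ-sound zero    n m []          t = ≡.refl , ≡.sym (ℕₚ.≡ᵇ⇒≡ n 0 t)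
partsBᵇ-sound (suc r) n m (suc x ∷ μ) t
  with x<n⊓m , t′ ← Equivalence.to T-∧ t
  with len , deg ← partsBᵇ-sound r (n ∸ suc x) (suc x) μ t′ =
  ≡.cong suc len , ≡.trans (≡.cong (suc x ℕ.+_) deg) (ℕₚ.m+[n∸m]≡n x<n)
  where x<n = ℕₚ.≤-trans (ℕₚ.<ᵇ⇒< x _ x<n⊓m) (ℕₚ.m⊓n≤m n m)

partsBᵇ-complete : ∀ r n m μ → All (_≢ 0) μ → Linked _≥_ (m ∷ μ) →
                   length μ ≡ r → degree μ ≡ n → T (partsBᵇ r n m μ)
partsBᵇ-complete zero    _ m []          _         _            ≡.refl ≡.refl = _
partsBᵇ-complete (suc r) _ m (zero  ∷ μ) (0≢0 ∷ _) _            _      _      = ⊥-elim (0≢0 ≡.refl)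
partsBᵇ-complete (suc r) _ m (suc x ∷ μ) (_ ∷ pos) (x<m ∷ link) ≡.refl ≡.refl =
  Equivalence.from T-∧
    ( ℕₚ.<⇒<ᵇ (ℕₚ.⊓-glb (ℕₚ.m≤m+n (suc x) (degree μ)) x<m)
    , partsBᵇ-complete r _ (suc x) μ pos link ≡.refl (≡.sym (ℕₚ.m+n∸m≡n (suc x) (degree μ))))

partsBᵇ-sortDesc : ∀ r n α →
  partsBᵇ r n n (sortDesc (nonzeros α)) ≡ (degree α ≡ᵇ n) ∧ (#support α ≡ᵇ r)
partsBᵇ-sortDesc r n α = T-ext sound complete
  where
  μ = sortDesc (nonzeros α)
  μ↭ : μ ↭ nonzeros α
  μ↭ = sortDesc-↭ (nonzeros α)
  length-μ : length μ ≡ #support α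
  length-μ = ↭-length μ↭
  degree-μ : degree μ ≡ degree α
  degree-μ = ≡.trans (ℕₗ.sum-↭ μ↭) (degree-nonzeros α)
  sound : T (partsBᵇ r n n μ) → T ((degree α ≡ᵇ n) ∧ (#support α ≡ᵇ r))
  sound t with len , deg ← partsBᵇ-sound r n n μ t =
    Equivalence.from T-∧ ( ℕₚ.≡⇒≡ᵇ _ _ (≡.trans (≡.sym degree-μ) deg)
                         , ℕₚ.≡⇒≡ᵇ _ _ (≡.trans (≡.sym length-μ) len))
  complete : T ((degree α ≡ᵇ n) ∧ (#support α ≡ᵇ r)) → T (partsBᵇ r n n μ)
  complete t with deg , len ← Equivalence.to T-∧ t =
    partsBᵇ-complete r n n μ (All-resp-↭ (↭-sym μ↭) (all-filter (λ a → ¬? (a ℕ.≟ 0)) α))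
      (≡.subst (λ d → Linked _≥_ (d ∷ μ)) degree-μ≡n (Linked-≥-degree (sortDesc-decreasing (nonzeros α))))
      (≡.trans length-μ (ℕₚ.≡ᵇ⇒≡ _ _ len)) degree-μ≡n
    where degree-μ≡n = ≡.trans degree-μ (ℕₚ.≡ᵇ⇒≡ _ _ deg)

module SeriesAlgebra {c ℓ} (F : Field c ℓ) (p q : Field.Carrier F) where
  open Field F hiding (zero)
  open Sym F p q
  open SemiringSums semiring
  open import Relation.Binary.Reasoning.Setoid setoid
  open import Algebra.Properties.CommutativeSemigroup *-commutativeSemigroup using (x∙yz≈y∙xz)

  sumₛ-apply : ∀ fs α → sumₛ fs α ≡ sum (map (λ f → f α) fs)
  sumₛ-apply []       α = ≡.refl
  sumₛ-apply (f ∷ fs) α = ≡.cong (λ s → f α + s) (sumₛ-apply fs α)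

  *ₚ-apply : ∀ A B n α → (A *ₚ B) n α ≡ ∑[ i < suc n ] (A i *ₛ B (n ∸ i)) α
  *ₚ-apply A B n α =
    ≡.trans (sumₛ-apply (map (λ i → A i *ₛ B (n ∸ i)) (upTo (suc n))) α)
            (≡.trans (≡.cong sum (≡.sym (List.map-∘ (upTo (suc n))))) (sum-map-upTo _ (suc n)))

  *ₛ-cong : ∀ {f f′ g g′} → f ≈ₛ f′ → g ≈ₛ g′ → (f *ₛ g) ≈ₛ (f′ *ₛ g′)
  *ₛ-cong f≈f′ g≈g′ α = sum-map-cong (splits α) (λ { (β , γ) → *-cong (f≈f′ β) (g≈g′ γ) })

  *ₛ-scaleˡ : ∀ k f g → ((k ·ₛ f) *ₛ g) ≈ₛ (k ·ₛ (f *ₛ g))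
  *ₛ-scaleˡ k f g α = trans (sum-map-cong (splits α) (λ { (β , γ) → *-assoc k (f β) (g γ) }))
                            (sym (*-distribˡ-sum-map k _ (splits α)))

  *ₛ-scaleʳ : ∀ k f g → (f *ₛ (k ·ₛ g)) ≈ₛ (k ·ₛ (f *ₛ g))
  *ₛ-scaleʳ k f g α = trans (sum-map-cong (splits α) (λ { (β , γ) → x∙yz≈y∙xz (f β) k (g γ) }))
                            (sym (*-distribˡ-sum-map k _ (splits α)))

  boolCoeff-∧ : ∀ a b → boolCoeff (a ∧ b) ≈ boolCoeff a * boolCoeff b
  boolCoeff-∧ true  b = sym (*-identityˡ _)
  boolCoeff-∧ false b = sym (zeroˡ _)

  boolCoeff-∧-false : ∀ a → boolCoeff (a ∧ false) ≈ 0#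
  boolCoeff-∧-false true  = refl
  boolCoeff-∧-false false = refl

  sum-splits-∷ : ∀ a α (f : Mon × Mon → Carrier) →
    sum (map f (splits (a ∷ α)))
      ≈ ∑[ k < suc a ] sum (map (λ { (β , γ) → f (k ∷ β , (a ∸ k) ∷ γ) }) (splits α))
  sum-splits-∷ a α f = begin
    sum (map f (concatMap G (upTo (suc a))))            ≈⟨ sum-map-concatMap f G (upTo (suc a)) ⟩
    sum (map (λ k → sum (map f (G k))) (upTo (suc a)))  ≡⟨ sum-map-upTo _ (suc a) ⟩
    ∑[ k < suc a ] sum (map f (G k))                    ≈⟨ ∑<-cong (suc a) (λ k _ → reflexive (≡.cong sum
                                                              (List.map-∘ {g = f} {f = φ k} (splits α)))) ⟨
    _                                                   ∎
    where
    φ : ℕ → Mon × Mon → Mon × Mon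
    φ k (β , γ) = (k ∷ β , (a ∸ k) ∷ γ)
    G : ℕ → List (Mon × Mon)
    G k = map (φ k) (splits α)

  sum-splits-cong : ∀ α {f g : Mon × Mon → Carrier} →
    (∀ β γ → degree β ℕ.+ degree γ ≡ degree α → f (β , γ) ≈ g (β , γ)) →
    sum (map f (splits α)) ≈ sum (map g (splits α))
  sum-splits-cong []      f≈g = +-cong (f≈g [] [] ≡.refl) refl
  sum-splits-cong (a ∷ α) f≈g = begin
    _  ≈⟨ sum-splits-∷ a α _ ⟩
    _  ≈⟨ ∑<-cong (suc a) (λ k k≤a → sum-splits-cong α (λ β γ eq → f≈g (k ∷ β) ((a ∸ k) ∷ γ) (degrees k≤a eq))) ⟩
    _  ≈⟨ sum-splits-∷ a α _ ⟨
    _  ∎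
    where
    degrees : ∀ {k x y} → k < suc a → x ℕ.+ y ≡ degree α → (k ℕ.+ x) ℕ.+ ((a ∸ k) ℕ.+ y) ≡ a ℕ.+ degree α
    degrees {k} {x} {y} (s≤s k≤a) eq =
      ≡.trans (ℕ-interchange k x (a ∸ k) y) (≡.cong₂ ℕ._+_ (ℕₚ.m+[n∸m]≡n k≤a) eq)

module ElementaryAndComplete {c ℓ} (F : Field c ℓ) (p q : Field.Carrier F) where
  open Field F hiding (zero)
  open Sym F p q
  open FieldProperties F
  open SeriesAlgebra F p q
  open SemiringSums semiring
  open import Relation.Binary.Reasoning.Setoid setoid
  open import Algebra.Properties.Ring ring using (-0#≈0#)
  open import Algebra.Properties.CommutativeSemigroup *-commutativeSemigroup using (x∙yz≈y∙xz)

  allMonomials : Series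
  allMonomials _ = 1#

  h : ℕ → Series
  h l α = boolCoeff (degree α ≡ᵇ l)

  e*allMonomials : ∀ k α → (e k *ₛ allMonomials) α ≈ natCast F (#support α C k)
  e*allMonomials zero    []          = +-cong (*-identityʳ 1#) refl
  e*allMonomials (suc k) []          = trans (+-cong (zeroˡ 1#) refl) (+-identityʳ 0#)
  e*allMonomials k       (zero ∷ α)  = trans (sum-splits-∷ 0 α _) (trans (+-identityʳ _) (e*allMonomials k α))
  -- Only the exponents 0 and 1 of the first variable contribute; Pascal's rule combines them.
  e*allMonomials k       (suc a ∷ α) =
    trans (sum-splits-∷ (suc a) α _)
          (trans (+-cong refl (+-cong refl (∑<-zero a (λ _ _ → sum-map-zero (splits α) (λ _ → zeroˡ 1#)))))
                 (pascal k))
    where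
    using-x : ℕ → Carrier
    using-x k = sum (map (λ { (β , γ) → e k (1 ∷ β) * 1# }) (splits α))
    pascal : ∀ k → (e k *ₛ allMonomials) α + (using-x k + 0#) ≈ natCast F (suc (#support α) C k)
    pascal zero = begin
      (e 0 *ₛ allMonomials) α + (using-x 0 + 0#)  ≈⟨ +-cong (e*allMonomials 0 α) (+-identityʳ _) ⟩
      (1# + 0#) + using-x 0                       ≈⟨ +-cong refl (sum-map-zero (splits α) (λ { (β , γ) →
                                                       trans (*-identityʳ _) (boolCoeff-∧-false (allB (_≤ᵇ 1) β)) })) ⟩
      (1# + 0#) + 0#                              ≈⟨ +-identityʳ _ ⟩
      1# + 0#                                     ∎
    pascal (suc k) = begin
      (e (suc k) *ₛ allMonomials) α + (using-x (suc k) + 0#)  ≈⟨ +-cong (e*allMonomials (suc k) α) (+-identityʳ _) ⟩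
      natCast F (s C suc k) + (e k *ₛ allMonomials) α         ≈⟨ +-cong refl (e*allMonomials k α) ⟩
      natCast F (s C suc k) + natCast F (s C k)               ≈⟨ +-comm _ _ ⟩
      natCast F (s C k) + natCast F (s C suc k)               ≈⟨ natCast-+ (s C k) (s C suc k) ⟨
      natCast F (s C k ℕ.+ s C suc k)                         ≡⟨ ≡.cong (natCast F) (nCk+nC[k+1]≡[n+1]C[k+1] s k) ⟩
      natCast F (suc s C suc k)                               ∎
      where s = #support α

  e*h : ∀ k l α → (e k *ₛ h l) α ≈ boolCoeff (degree α ≡ᵇ k ℕ.+ l) * natCast F (#support α C k)
  e*h k l α = begin
    (e k *ₛ h l) α                                              ≈⟨ sum-splits-cong α split-term ⟩
    sum (map (λ { (β , γ) → [d=k+l] * (e k β * 1#) }) (splits α))  ≈⟨ *-distribˡ-sum-map [d=k+l] _ (splits α) ⟨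
    [d=k+l] * (e k *ₛ allMonomials) α                           ≈⟨ *-cong refl (e*allMonomials k α) ⟩
    [d=k+l] * natCast F (#support α C k)                        ∎
    where
    [d=k+l] = boolCoeff (degree α ≡ᵇ k ℕ.+ l)
    indicators : ∀ A d₁ d₂ → boolCoeff (A ∧ (d₁ ≡ᵇ k)) * boolCoeff (d₂ ≡ᵇ l)
                             ≈ boolCoeff (d₁ ℕ.+ d₂ ≡ᵇ k ℕ.+ l) * (boolCoeff (A ∧ (d₁ ≡ᵇ k)) * 1#)
    indicators A d₁ d₂ with d₁ ℕ.≟ k
    ... | yes ≡.refl rewrite ≡ᵇ-refl d₁ | +-≡ᵇ d₁ d₂ l = trans (*-comm _ _) (*-cong refl (sym (*-identityʳ _)))
    ... | no d₁≢k rewrite ≢⇒≡ᵇ-false d₁≢k = begin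
      boolCoeff (A ∧ false) * boolCoeff (d₂ ≡ᵇ l)  ≈⟨ trans (*-cong (boolCoeff-∧-false A) refl) (zeroˡ _) ⟩
      0#                                          ≈⟨ zeroʳ _ ⟨
      [d=k+l]′ * 0#                               ≈⟨ *-cong refl (trans (*-cong (boolCoeff-∧-false A) refl) (zeroˡ 1#)) ⟨
      [d=k+l]′ * (boolCoeff (A ∧ false) * 1#)     ∎
      where [d=k+l]′ = boolCoeff (d₁ ℕ.+ d₂ ≡ᵇ k ℕ.+ l)
    split-term : ∀ β γ → degree β ℕ.+ degree γ ≡ degree α → e k β * h l γ ≈ [d=k+l] * (e k β * 1#)
    split-term β γ eq = ≡.subst (λ d → e k β * h l γ ≈ boolCoeff (d ≡ᵇ k ℕ.+ l) * (e k β * 1#)) eq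
                                (indicators (allB (_≤ᵇ 1) β) (degree β) (degree γ))

  e*h-alternating : ∀ n α →
    - ∑[ i < suc n ] (e (suc i) *ₛ (sign F (n ∸ i) ·ₛ h (n ∸ i))) α ≈ sign F (suc n) * h (suc n) α
  e*h-alternating n α = begin
    - ∑[ i < suc n ] (e (suc i) *ₛ (sign F (n ∸ i) ·ₛ h (n ∸ i))) α  ≈⟨ -‿cong (∑<-cong (suc n) term) ⟩
    - ∑[ i < suc n ] (h (suc n) α * alt i)            ≈⟨ -‿cong (*-distribˡ-∑< (h (suc n) α) (suc n) alt) ⟨
    - (h (suc n) α * ∑< (suc n) alt)                  ≈⟨ signed (degree α ≡ᵇ suc n) ≡.refl ⟩
    sign F (suc n) * h (suc n) α                      ∎
    where
    alt : ℕ → Carrier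
    alt i = sign F (n ∸ i) * natCast F (#support α C suc i)
    term : ∀ i → i < suc n → (e (suc i) *ₛ (sign F (n ∸ i) ·ₛ h (n ∸ i))) α ≈ h (suc n) α * alt i
    term i (s≤s i≤n) = begin
      (e (suc i) *ₛ (sign F (n ∸ i) ·ₛ h (n ∸ i))) α  ≈⟨ *ₛ-scaleʳ (sign F (n ∸ i)) (e (suc i)) (h (n ∸ i)) α ⟩
      sign F (n ∸ i) * (e (suc i) *ₛ h (n ∸ i)) α     ≈⟨ *-cong refl (e*h (suc i) (n ∸ i) α) ⟩
      sign F (n ∸ i) * (boolCoeff (degree α ≡ᵇ suc (i ℕ.+ (n ∸ i))) * binom)
        ≡⟨ ≡.cong (λ t → sign F (n ∸ i) * (boolCoeff (degree α ≡ᵇ suc t) * binom)) (ℕₚ.m+[n∸m]≡n i≤n) ⟩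
      sign F (n ∸ i) * (h (suc n) α * binom)          ≈⟨ x∙yz≈y∙xz _ _ _ ⟩
      h (suc n) α * alt i                             ∎
      where binom = natCast F (#support α C suc i)
    signed : ∀ b → (degree α ≡ᵇ suc n) ≡ b → - (boolCoeff b * ∑< (suc n) alt) ≈ sign F (suc n) * boolCoeff b
    signed false _  = trans (-‿cong (zeroˡ _)) (trans -0#≈0# (sym (zeroʳ _)))
    signed true  eq = begin
      - (1# * ∑< (suc n) alt)  ≈⟨ -‿cong (trans (*-identityˡ _) (alternating-binomial-sign n (#support α) 1≤s s≤n+1)) ⟩
      - sign F n               ≈⟨ sign-suc n ⟨
      sign F (suc n)           ≈⟨ *-identityʳ _ ⟨
      sign F (suc n) * 1#      ∎
      where
      degree≡n+1 : degree α ≡ suc n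
      degree≡n+1 = ℕₚ.≡ᵇ⇒≡ _ _ (≡.subst T (≡.sym eq) _)
      1≤s : 1 ≤ #support α
      1≤s = 1≤degree⇒1≤#support α (≡.subst (1 ≤_) (≡.sym degree≡n+1) (s≤s z≤n))
      s≤n+1 : #support α ≤ suc n
      s≤n+1 = ≡.subst (#support α ≤_) degree≡n+1 (#support≤degree α)

  sumₛ-zipWith : ∀ (A : PS) {m} (ks : Vec ℕ m) (gs : Vec Series m) (K : ℕ → ℕ) (G : ℕ → Series) →
    (∀ i → Vec.lookup ks i ≡ K (toℕ i)) → (∀ i → Vec.lookup gs i ≈ₛ G (toℕ i)) →
    sumₛ (Vec.toList (Vec.zipWith (λ k g → A k *ₛ g) ks gs)) ≈ₛ (λ α → ∑[ i < m ] (A (K i) *ₛ G i) α)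
  sumₛ-zipWith A []       []       K G _   _   α = refl
  sumₛ-zipWith A (k ∷ ks) (g ∷ gs) K G ks≡ gs≈ α =
    +-cong (≡.subst (λ t → (A k *ₛ g) α ≈ (A t *ₛ G 0) α) (ks≡ Fin.zero) (*ₛ-cong (λ _ → refl) (gs≈ Fin.zero) α))
           (sumₛ-zipWith A ks gs (K ∘ suc) (G ∘ suc) (ks≡ ∘ Fin.suc) (gs≈ ∘ Fin.suc) α)

  allB-≡ᵇ0 : ∀ α → allB (_≡ᵇ 0) α ≡ (degree α ≡ᵇ 0)
  allB-≡ᵇ0 []          = ≡.refl
  allB-≡ᵇ0 (zero ∷ α)  = allB-≡ᵇ0 α
  allB-≡ᵇ0 (suc a ∷ α) = ≡.refl

  lookup-invVec-E : ∀ n (i : Fin (suc n)) →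
                    Vec.lookup (invVec E n) i ≈ₛ (sign F (n ∸ toℕ i) ·ₛ h (n ∸ toℕ i))
  lookup-invVec-E zero    Fin.zero    α = trans (reflexive (≡.cong boolCoeff (allB-≡ᵇ0 α))) (sym (*-identityˡ _))
  lookup-invVec-E (suc n) Fin.zero    α =
    trans (-‿cong (sumₛ-zipWith E ks (invVec E n) suc (λ i → sign F (n ∸ i) ·ₛ h (n ∸ i))
                                lookup-ks (lookup-invVec-E n) α))
          (e*h-alternating n α)
    where
    ks = Vec.map (λ i → suc (toℕ i)) (Vec.allFin (suc n))
    lookup-ks : ∀ i → Vec.lookup ks i ≡ suc (toℕ i)
    lookup-ks i = ≡.trans (Vec.lookup-map i _ (Vec.allFin (suc n))) (≡.cong (suc ∘ toℕ) (Vec.lookup-allFin i))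
  lookup-invVec-E (suc n) (Fin.suc i) = lookup-invVec-E n i

  inv-E : ∀ m → inv E m ≈ₛ (sign F m ·ₛ h m)
  inv-E zero    = lookup-invVec-E zero Fin.zero
  inv-E (suc m) = lookup-invVec-E (suc m) Fin.zero

module PQDerivatives {c ℓ} (F : Field c ℓ) (p q : Field.Carrier F) where
  open Field F hiding (zero)
  open Sym F p q
  open FieldProperties F
  open PowerDifference F using (powDiffCoeff; evalPoly2-powDiff)
  open import Relation.Binary.Reasoning.Setoid setoid
  open import Algebra.Properties.Ring ring using ([y-z]x≈yx-zx)
  open import Algebra.Properties.CommutativeSemigroup *-commutativeSemigroup using (x∙yz≈yx∙z)

  D-coeff : ∀ A n → D A n ≈ₛ (qn (suc n) ·ₛ A (suc n))
  D-coeff A n α = begin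
    (p - q) ⁻¹ * (P * X + - (Q * X))  ≈⟨ *-cong refl ([y-z]x≈yx-zx X P Q) ⟨
    (p - q) ⁻¹ * ((P - Q) * X)        ≈⟨ x∙yz≈yx∙z _ _ _ ⟩
    qn (suc n) * X                    ∎
    where
    P = pow F p (suc n)
    Q = pow F q (suc n)
    X = A (suc n) α

  qRising : ℕ → ℕ → Carrier
  qRising zero    k = 1#
  qRising (suc r) k = qn (suc k) * qRising r (suc k)

  Dpow-E : ∀ r k → Dpow r E k ≈ₛ (qRising r k ·ₛ e (r ℕ.+ k))
  Dpow-E zero    k α = sym (*-identityˡ _)
  Dpow-E (suc r) k α = begin
    D (Dpow r E) k α                                      ≈⟨ D-coeff (Dpow r E) k α ⟩
    qn (suc k) * Dpow r E (suc k) α                       ≈⟨ *-cong refl (Dpow-E r (suc k) α) ⟩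
    qn (suc k) * (qRising r (suc k) * e (r ℕ.+ suc k) α)  ≈⟨ *-assoc _ _ _ ⟨
    qRising (suc r) k * e (r ℕ.+ suc k) α                 ≡⟨ ≡.cong (λ t → qRising (suc r) k * e t α) (ℕₚ.+-suc r k) ⟩
    qRising (suc r) k * e (suc r ℕ.+ k) α                 ∎

  qfact-qRising : ∀ r k → qfact k * qRising r k ≈ qfact (r ℕ.+ k)
  qfact-qRising zero    k = *-identityʳ _
  qfact-qRising (suc r) k = begin
    qfact k * (qn (suc k) * qRising r (suc k))  ≈⟨ *-assoc _ _ _ ⟨
    qfact (suc k) * qRising r (suc k)           ≈⟨ qfact-qRising r (suc k) ⟩
    qfact (r ℕ.+ suc k)                         ≡⟨ ≡.cong qfact (ℕₚ.+-suc r k) ⟩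
    qfact (suc r ℕ.+ k)                         ∎

  module _ (indep : AlgIndep F p q) where

    powDiff-nonzero : ∀ k → ¬ pow F p (suc k) - pow F q (suc k) ≈ 0#
    powDiff-nonzero k powDiff≈0 =
      indep (suc (suc k)) (λ i j → powDiffCoeff k (toℕ i) (toℕ j)) (Fin.fromℕ (suc k) , Fin.zero , leading≢0)
            (trans (evalPoly2-powDiff k p q) powDiff≈0)
      where
      leading≢0 : ¬ powDiffCoeff k (toℕ (Fin.fromℕ (suc k))) 0 ≡ + 0
      leading≢0 rewrite Fin.toℕ-fromℕ k | ≡ᵇ-refl k = λ ()

    qn-nonzero : ∀ k → ¬ qn (suc k) ≈ 0#
    qn-nonzero k = *-nonzero (powDiff-nonzero k) (⁻¹-nonzero p-q≉0)
      where
      p-q≉0 : ¬ p - q ≈ 0#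
      p-q≉0 p-q≈0 = powDiff-nonzero 0 (trans (+-cong (*-identityʳ p) (-‿cong (*-identityʳ q))) p-q≈0)

    qfact-nonzero : ∀ k → ¬ qfact k ≈ 0#
    qfact-nonzero zero    = 1≉0
    qfact-nonzero (suc k) = *-nonzero (qfact-nonzero k) (qn-nonzero k)

    qRising≈qbinom : ∀ r k → qfact r ⁻¹ * qRising r k ≈ qbinom (r ℕ.+ k) r
    qRising≈qbinom r k = begin
      qfact r ⁻¹ * qRising r k                             ≈⟨ *-identityʳ _ ⟨
      (qfact r ⁻¹ * qRising r k) * 1#                      ≈⟨ *-cong refl (inverse (qfact k) (qfact-nonzero k)) ⟨
      (qfact r ⁻¹ * qRising r k) * (qfact k * qfact k ⁻¹)
        ≈⟨ Solver.solve 4 (λ a b c d → ((a ⊗ b) ⊗ (c ⊗ d)) ⊜ ((c ⊗ b) ⊗ (a ⊗ d))) refl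
                          (qfact r ⁻¹) (qRising r k) (qfact k) (qfact k ⁻¹) ⟩
      (qfact k * qRising r k) * (qfact r ⁻¹ * qfact k ⁻¹)
        ≈⟨ *-cong (qfact-qRising r k) (sym (⁻¹-distrib-* (qfact-nonzero r) (qfact-nonzero k))) ⟩
      qfact (r ℕ.+ k) * (qfact r * qfact k) ⁻¹
        ≡⟨ ≡.cong (λ t → qfact (r ℕ.+ k) * (qfact r * qfact t) ⁻¹) (ℕₚ.m+n∸m≡n r k) ⟨
      qbinom (r ℕ.+ k) r                                   ∎
      where open Solver

module PartitionSums {c ℓ} (F : Field c ℓ) (p q : Field.Carrier F) where
  open Field F hiding (zero)
  open Sym F p q
  open SeriesAlgebra F p q
  open SemiringSums semiring
  open import Relation.Binary.Reasoning.Setoid setoid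

  sum-indicator-partsB : ∀ r n m μ →
    sum (map (λ ν → boolCoeff (does (≡-dec ℕ._≟_ μ ν))) (partsB r n m)) ≈ boolCoeff (partsBᵇ r n m μ)
  sum-indicator-partsB zero    zero    m []      = +-identityʳ _
  sum-indicator-partsB zero    zero    m (_ ∷ _) = +-identityʳ _
  sum-indicator-partsB zero    (suc n) m []      = refl
  sum-indicator-partsB zero    (suc n) m (_ ∷ _) = refl
  sum-indicator-partsB (suc r) n       m μ       = begin
    sum (map [μ≡_] (concatMap G (rangeList 1 N)))            ≈⟨ sum-map-concatMap [μ≡_] G (rangeList 1 N) ⟩
    sum (map (λ k → sum (map [μ≡_] (G k))) (rangeList 1 N))  ≡⟨ sum-map-rangeList _ 1 N ⟩
    ∑[ i < N ] sum (map [μ≡_] (G (suc i)))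
      ≈⟨ ∑<-cong N (λ i _ → reflexive (≡.cong sum (List.map-∘ (P i)))) ⟨
    ∑[ i < N ] sum (map (λ ν → [μ≡ suc i ∷ ν ]) (P i))      ≈⟨ by-head μ ⟩
    boolCoeff (partsBᵇ (suc r) n m μ)                        ∎
    where
    N = n ⊓ m
    [μ≡_] : List ℕ → Carrier
    [μ≡ ν ] = boolCoeff (does (≡-dec ℕ._≟_ μ ν))
    P : ℕ → List (List ℕ)
    P i = partsB r (n ∸ suc i) (suc i)
    G : ℕ → List (List ℕ)
    G k = map (k ∷_) (partsB r (n ∸ k) k)
    by-head : ∀ μ → ∑[ i < N ] sum (map (λ ν → boolCoeff (does (≡-dec ℕ._≟_ μ (suc i ∷ ν)))) (P i))
                    ≈ boolCoeff (partsBᵇ (suc r) n m μ)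
    by-head []          = ∑<-zero N (λ i _ → sum-map-zero (P i) (λ _ → refl))
    by-head (zero ∷ μ)  = ∑<-zero N (λ i _ → sum-map-zero (P i) (λ _ → refl))
    by-head (suc x ∷ μ) = trans (∑<-cong N (λ i _ → term i)) (select (x <ᵇ N) ≡.refl)
      where
      rest : ℕ → Carrier
      rest i = boolCoeff (partsBᵇ r (n ∸ suc i) (suc i) μ)
      term : ∀ i → sum (map (λ ν → boolCoeff ((x ≡ᵇ i) ∧ does (≡-dec ℕ._≟_ μ ν))) (P i))
                   ≈ boolCoeff (x ≡ᵇ i) * rest i
      term i = begin
        sum (map (λ ν → boolCoeff ((x ≡ᵇ i) ∧ does (≡-dec ℕ._≟_ μ ν))) (P i))
          ≈⟨ sum-map-cong (P i) (λ ν → boolCoeff-∧ (x ≡ᵇ i) _) ⟩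
        sum (map (λ ν → boolCoeff (x ≡ᵇ i) * boolCoeff (does (≡-dec ℕ._≟_ μ ν))) (P i))
          ≈⟨ *-distribˡ-sum-map (boolCoeff (x ≡ᵇ i)) _ (P i) ⟨
        boolCoeff (x ≡ᵇ i) * sum (map (λ ν → boolCoeff (does (≡-dec ℕ._≟_ μ ν))) (P i))
          ≈⟨ *-cong refl (sum-indicator-partsB r (n ∸ suc i) (suc i) μ) ⟩
        boolCoeff (x ≡ᵇ i) * rest i
          ∎
      select : ∀ b → (x <ᵇ N) ≡ b →
               ∑[ i < N ] (boolCoeff (x ≡ᵇ i) * rest i) ≈ boolCoeff (b ∧ partsBᵇ r (n ∸ suc x) (suc x) μ)
      select true  x<ᵇN = begin
        ∑[ i < N ] (boolCoeff (x ≡ᵇ i) * rest i)  ≈⟨ ∑<-single N (ℕₚ.<ᵇ⇒< x N (≡.subst T (≡.sym x<ᵇN) _)) off-x ⟩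
        boolCoeff (x ≡ᵇ x) * rest x               ≡⟨ ≡.cong (λ t → boolCoeff t * rest x) (≡ᵇ-refl x) ⟩
        1# * rest x                               ≈⟨ *-identityˡ _ ⟩
        rest x                                    ∎
        where
        off-x : ∀ i → i < N → i ≢ x → boolCoeff (x ≡ᵇ i) * rest i ≈ 0#
        off-x i _ i≢x = trans (*-cong (reflexive (≡.cong boolCoeff (≢⇒≡ᵇ-false (i≢x ∘ ≡.sym)))) refl) (zeroˡ _)
      select false x≮ᵇN = ∑<-zero N off
        where
        off : ∀ i → i < N → boolCoeff (x ≡ᵇ i) * rest i ≈ 0#
        off i i<N = trans (*-cong (reflexive (≡.cong boolCoeff (≢⇒≡ᵇ-false x≢i))) refl) (zeroˡ _)
          where
          x≢i : x ≢ i
          x≢i ≡.refl = ≡.subst T x≮ᵇN (ℕₚ.<⇒<ᵇ i<N)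

  pnr-coeff : ∀ n j α → pnr n j α ≈ boolCoeff ((degree α ≡ᵇ n) ∧ (#support α ≡ᵇ j))
  pnr-coeff n j α = begin
    pnr n j α                                          ≡⟨ sumₛ-apply (map m (partitions n j)) α ⟩
    sum (map (λ f → f α) (map m (partsB j n n)))       ≡⟨ ≡.cong sum (List.map-∘ (partsB j n n)) ⟨
    sum (map (λ ν → m ν α) (partsB j n n))             ≈⟨ sum-indicator-partsB j n n (sortDesc (nonzeros α)) ⟩
    boolCoeff (partsBᵇ j n n (sortDesc (nonzeros α)))  ≡⟨ ≡.cong boolCoeff (partsBᵇ-sortDesc j n α) ⟩
    boolCoeff ((degree α ≡ᵇ n) ∧ (#support α ≡ᵇ j))    ∎

module CoefficientComparison {c ℓ} (F : Field c ℓ) (p q : Field.Carrier F) (indep : AlgIndep F p q) where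
  open Field F hiding (zero)
  open Sym F p q
  open FieldProperties F
  open SeriesAlgebra F p q
  open ElementaryAndComplete F p q
  open PQDerivatives F p q
  open PartitionSums F p q
  open SemiringSums semiring
  open import Relation.Binary.Reasoning.Setoid setoid
  open import Algebra.Properties.CommutativeSemigroup *-commutativeSemigroup using (x∙yz≈y∙xz)

  -- The coefficient of the left side at a monomial of degree r + k in s variables.
  lhsCoeff : ℕ → ℕ → ℕ → Carrier
  lhsCoeff r k s = ∑[ i < suc k ] (sign F i * (qbinom (r ℕ.+ i) r * natCast F (s C (r ℕ.+ i))))

  bracketP-coeff : ∀ r k α → bracketP (r ℕ.+ k) r α ≈ h (r ℕ.+ k) α * lhsCoeff r k (#support α)
  bracketP-coeff r k α = begin
    bracketP (r ℕ.+ k) r α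
      ≡⟨ ≡.cong (λ t → sign F t * (qfact r ⁻¹ * (Dpow r E *ₚ inv E) t α)) (ℕₚ.m+n∸m≡n r k) ⟩
    sign F k * (qfact r ⁻¹ * (Dpow r E *ₚ inv E) k α)
      ≡⟨ ≡.cong (λ t → sign F k * (qfact r ⁻¹ * t)) (*ₚ-apply (Dpow r E) (inv E) k α) ⟩
    sign F k * (qfact r ⁻¹ * ∑< (suc k) product)
      ≈⟨ *-cong refl (*-distribˡ-∑< (qfact r ⁻¹) (suc k) product) ⟩
    sign F k * ∑[ i < suc k ] (qfact r ⁻¹ * product i)
      ≈⟨ *-distribˡ-∑< (sign F k) (suc k) (λ i → qfact r ⁻¹ * product i) ⟩
    ∑[ i < suc k ] (sign F k * (qfact r ⁻¹ * product i))
      ≈⟨ ∑<-cong (suc k) term ⟩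
    ∑[ i < suc k ] (h (r ℕ.+ k) α * summand i)
      ≈⟨ *-distribˡ-∑< (h (r ℕ.+ k) α) (suc k) summand ⟨
    h (r ℕ.+ k) α * lhsCoeff r k (#support α)
      ∎
    where
    product : ℕ → Carrier
    product i = (Dpow r E i *ₛ inv E (k ∸ i)) α
    summand : ℕ → Carrier
    summand i = sign F i * (qbinom (r ℕ.+ i) r * natCast F (#support α C (r ℕ.+ i)))
    term : ∀ i → i < suc k → sign F k * (qfact r ⁻¹ * product i) ≈ h (r ℕ.+ k) α * summand i
    term i (s≤s i≤k) = begin
      σk * (Q * product i)
        ≈⟨ *-cong refl (*-cong refl (*ₛ-cong (Dpow-E r i) (inv-E (k ∸ i)) α)) ⟩
      σk * (Q * ((R ·ₛ e (r ℕ.+ i)) *ₛ (σ′ ·ₛ h (k ∸ i))) α)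
        ≈⟨ *-cong refl (*-cong refl (trans (*ₛ-scaleˡ _ _ _ α) (*-cong refl (*ₛ-scaleʳ _ _ _ α)))) ⟩
      σk * (Q * (R * (σ′ * (e (r ℕ.+ i) *ₛ h (k ∸ i)) α)))
        ≈⟨ *-cong refl (*-cong refl (*-cong refl (*-cong refl (e*h (r ℕ.+ i) (k ∸ i) α)))) ⟩
      σk * (Q * (R * (σ′ * (boolCoeff (degree α ≡ᵇ (r ℕ.+ i) ℕ.+ (k ∸ i)) * binom))))
        ≡⟨ ≡.cong (λ t → σk * (Q * (R * (σ′ * (boolCoeff (degree α ≡ᵇ t) * binom))))) degrees ⟩
      σk * (Q * (R * (σ′ * (H * binom))))   ≈⟨ *-cong refl (*-assoc Q R _) ⟨
      σk * ((Q * R) * (σ′ * (H * binom)))   ≈⟨ *-cong refl (x∙yz≈y∙xz (Q * R) σ′ _) ⟩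
      σk * (σ′ * ((Q * R) * (H * binom)))   ≈⟨ *-assoc σk σ′ _ ⟨
      (σk * σ′) * ((Q * R) * (H * binom))   ≈⟨ *-cong refl (x∙yz≈y∙xz (Q * R) H binom) ⟩
      (σk * σ′) * (H * ((Q * R) * binom))   ≈⟨ x∙yz≈y∙xz (σk * σ′) H _ ⟩
      H * ((σk * σ′) * ((Q * R) * binom))
        ≈⟨ *-cong refl (*-cong (sign-∸ i≤k) (*-cong (qRising≈qbinom indep r i) refl)) ⟩
      H * summand i                         ∎
      where
      σk = sign F k
      σ′ = sign F (k ∸ i)
      Q = qfact r ⁻¹
      R = qRising r i
      H = h (r ℕ.+ k) α
      binom = natCast F (#support α C (r ℕ.+ i))
      degrees : (r ℕ.+ i) ℕ.+ (k ∸ i) ≡ r ℕ.+ k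
      degrees = ≡.trans (ℕₚ.+-assoc r i (k ∸ i)) (≡.cong (r ℕ.+_) (ℕₚ.m+[n∸m]≡n i≤k))

  rhs-coeff : ∀ r k α → rhs (r ℕ.+ k) r α
    ≈ ∑[ i < suc k ] (lhsCoeff r i (r ℕ.+ i) * boolCoeff ((degree α ≡ᵇ r ℕ.+ k) ∧ (#support α ≡ᵇ r ℕ.+ i)))
  rhs-coeff r k α = begin
    rhs (r ℕ.+ k) r α                                      ≡⟨ sumₛ-apply (map H (rangeList r (r ℕ.+ k))) α ⟩
    sum (map (λ f → f α) (map H (rangeList r (r ℕ.+ k))))  ≡⟨ ≡.cong sum (List.map-∘ (rangeList r (r ℕ.+ k))) ⟨
    sum (map (λ j → H j α) (rangeList r (r ℕ.+ k)))        ≡⟨ sum-map-rangeList _ r (r ℕ.+ k) ⟩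
    ∑< (suc (r ℕ.+ k) ∸ r) (λ i → H (r ℕ.+ i) α)           ≡⟨ ≡.cong (λ t → ∑< t (λ i → H (r ℕ.+ i) α)) (suc-+-∸ r k) ⟩
    ∑[ i < suc k ] H (r ℕ.+ i) α                           ≈⟨ ∑<-cong (suc k) (λ i _ →
                                                                *-cong (coeff≈lhsCoeff i) (pnr-coeff (r ℕ.+ k) (r ℕ.+ i) α)) ⟩
    _                                                      ∎
    where
    coeff : ℕ → Carrier
    coeff j = sum (map (λ l → sign F (l ∸ r) * (natCast F (j C l) * qbinom l r)) (rangeList r j))
    H : ℕ → Series
    H j = coeff j ·ₛ pnr (r ℕ.+ k) j
    suc-+-∸ : ∀ r m → suc (r ℕ.+ m) ∸ r ≡ suc m
    suc-+-∸ r m = ≡.trans (≡.cong (_∸ r) (≡.sym (ℕₚ.+-suc r m))) (ℕₚ.m+n∸m≡n r (suc m))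
    coeff≈lhsCoeff : ∀ i → coeff (r ℕ.+ i) ≈ lhsCoeff r i (r ℕ.+ i)
    coeff≈lhsCoeff i = begin
      coeff (r ℕ.+ i)                 ≡⟨ sum-map-rangeList _ r (r ℕ.+ i) ⟩
      ∑< (suc (r ℕ.+ i) ∸ r) summand  ≡⟨ ≡.cong (λ t → ∑< t summand) (suc-+-∸ r i) ⟩
      ∑< (suc i) summand              ≈⟨ ∑<-cong (suc i) (λ t _ → reorder t) ⟩
      lhsCoeff r i (r ℕ.+ i)          ∎
      where
      binom : ℕ → Carrier
      binom t = natCast F ((r ℕ.+ i) C (r ℕ.+ t))
      summand : ℕ → Carrier
      summand t = sign F ((r ℕ.+ t) ∸ r) * (binom t * qbinom (r ℕ.+ t) r)
      reorder : ∀ t → summand t ≈ sign F t * (qbinom (r ℕ.+ t) r * binom t)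
      reorder t = trans (reflexive (≡.cong (λ u → sign F u * (binom t * qbinom (r ℕ.+ t) r)) (ℕₚ.m+n∸m≡n r t)))
                        (*-cong refl (*-comm _ _))

  lhsCoeff-truncate : ∀ r i k → i ≤ k → lhsCoeff r k (r ℕ.+ i) ≈ lhsCoeff r i (r ℕ.+ i)
  lhsCoeff-truncate r i k i≤k = begin
    ∑< (suc k) f                                   ≡⟨ ≡.cong (λ t → ∑< (suc t) f) (ℕₚ.m+[n∸m]≡n i≤k) ⟨
    ∑< (suc i ℕ.+ (k ∸ i)) f                       ≈⟨ ∑<-+ (suc i) (k ∸ i) f ⟩
    ∑< (suc i) f + ∑[ j < k ∸ i ] f (suc i ℕ.+ j)  ≈⟨ +-cong refl (∑<-zero (k ∸ i) (λ j _ → vanish j)) ⟩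
    ∑< (suc i) f + 0#                              ≈⟨ +-identityʳ _ ⟩
    ∑< (suc i) f                                   ∎
    where
    f : ℕ → Carrier
    f j = sign F j * (qbinom (r ℕ.+ j) r * natCast F ((r ℕ.+ i) C (r ℕ.+ j)))
    vanish : ∀ j → f (suc i ℕ.+ j) ≈ 0#
    vanish j = begin
      f (suc i ℕ.+ j)
        ≡⟨ ≡.cong (λ t → sign F (suc i ℕ.+ j) * (qbinom (r ℕ.+ (suc i ℕ.+ j)) r * natCast F t))
                  (k>n⇒nCk≡0 (ℕₚ.+-monoʳ-< r (s≤s (ℕₚ.m≤m+n i j)))) ⟩
      sign F (suc i ℕ.+ j) * (qbinom (r ℕ.+ (suc i ℕ.+ j)) r * 0#)
        ≈⟨ trans (*-cong refl (zeroʳ _)) (zeroʳ _) ⟩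
      0#
        ∎

  lhsCoeff-as-sum : ∀ r k s → s ≤ r ℕ.+ k →
    lhsCoeff r k s ≈ ∑[ i < suc k ] (lhsCoeff r i (r ℕ.+ i) * boolCoeff (s ≡ᵇ r ℕ.+ i))
  lhsCoeff-as-sum r k s s≤r+k with r ℕ.≤? s
  ... | no r≰s = trans (∑<-zero (suc k) (λ i _ → vanish i)) (sym (∑<-zero (suc k) (λ i _ → unselected i)))
    where
    s<r+i : ∀ i → s < r ℕ.+ i
    s<r+i i = ℕₚ.<-≤-trans (ℕₚ.≰⇒> r≰s) (ℕₚ.m≤m+n r i)
    vanish : ∀ i → sign F i * (qbinom (r ℕ.+ i) r * natCast F (s C (r ℕ.+ i))) ≈ 0#
    vanish i = trans (*-cong refl (trans (*-cong refl (reflexive (≡.cong (natCast F) (k>n⇒nCk≡0 (s<r+i i)))))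
                                         (zeroʳ _)))
                     (zeroʳ _)
    unselected : ∀ i → lhsCoeff r i (r ℕ.+ i) * boolCoeff (s ≡ᵇ r ℕ.+ i) ≈ 0#
    unselected i = trans (*-cong refl (reflexive (≡.cong boolCoeff (≢⇒≡ᵇ-false (ℕₚ.<⇒≢ (s<r+i i)))))) (zeroʳ _)
  ... | yes r≤s with i₀ , ≡.refl ← ℕₚ.m≤n⇒∃[o]m+o≡n r≤s = begin
    lhsCoeff r k (r ℕ.+ i₀)                                      ≈⟨ lhsCoeff-truncate r i₀ k i₀≤k ⟩
    lhsCoeff r i₀ (r ℕ.+ i₀)                                     ≈⟨ *-identityʳ _ ⟨
    lhsCoeff r i₀ (r ℕ.+ i₀) * 1#                                ≡⟨ ≡.cong (λ t → lhsCoeff r i₀ (r ℕ.+ i₀) * boolCoeff t)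
                                                                            (≡.trans (+-≡ᵇ r i₀ i₀) (≡ᵇ-refl i₀)) ⟨
    lhsCoeff r i₀ (r ℕ.+ i₀) * boolCoeff (r ℕ.+ i₀ ≡ᵇ r ℕ.+ i₀)  ≈⟨ ∑<-single (suc k) (s≤s i₀≤k) unselected ⟨
    _                                                            ∎
    where
    i₀≤k = ℕₚ.+-cancelˡ-≤ r i₀ k s≤r+k
    unselected : ∀ i → i < suc k → i ≢ i₀ → lhsCoeff r i (r ℕ.+ i) * boolCoeff (r ℕ.+ i₀ ≡ᵇ r ℕ.+ i) ≈ 0#
    unselected i _ i≢i₀ =
      trans (*-cong refl (reflexive (≡.cong boolCoeff (≡.trans (+-≡ᵇ r i₀ i) (≢⇒≡ᵇ-false (i≢i₀ ∘ ≡.sym))))))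
            (zeroʳ _)

  coefficients-agree : ∀ r k → bracketP (r ℕ.+ k) r ≈ₛ rhs (r ℕ.+ k) r
  coefficients-agree r k α = begin
    bracketP (r ℕ.+ k) r α                     ≈⟨ bracketP-coeff r k α ⟩
    h (r ℕ.+ k) α * lhsCoeff r k (#support α)  ≈⟨ agree (degree α ≡ᵇ r ℕ.+ k) ≡.refl ⟩
    ∑[ i < suc k ] (lhsCoeff r i (r ℕ.+ i) * boolCoeff ((degree α ≡ᵇ r ℕ.+ k) ∧ (#support α ≡ᵇ r ℕ.+ i)))
                                               ≈⟨ rhs-coeff r k α ⟨
    rhs (r ℕ.+ k) r α                          ∎
    where
    agree : ∀ b → (degree α ≡ᵇ r ℕ.+ k) ≡ b → boolCoeff b * lhsCoeff r k (#support α)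
              ≈ ∑[ i < suc k ] (lhsCoeff r i (r ℕ.+ i) * boolCoeff (b ∧ (#support α ≡ᵇ r ℕ.+ i)))
    agree false _  = trans (zeroˡ _) (sym (∑<-zero (suc k) (λ i _ → zeroʳ (lhsCoeff r i (r ℕ.+ i)))))
    agree true  eq = trans (*-identityˡ _) (lhsCoeff-as-sum r k (#support α)
      (≡.subst (#support α ≤_) (ℕₚ.≡ᵇ⇒≡ _ _ (≡.subst T (≡.sym eq) _)) (#support≤degree α)))

proposition5p2 : ∀ {c ℓ} (F : Field c ℓ) (p q : Field.Carrier F) →
    AlgIndep F p q →
    ∀ (n r : ℕ) → 1 ≤ r → r ≤ n →
    Sym._≈ₛ_ F p q (Sym.bracketP F p q n r) (Sym.rhs F p q n r)
proposition5p2 F p q indep n r _ r≤n =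
  ≡.subst (λ n → Sym._≈ₛ_ F p q (Sym.bracketP F p q n r) (Sym.rhs F p q n r)) (ℕₚ.m+[n∸m]≡n r≤n)
          (CoefficientComparison.coefficients-agree F p q indep r (n ∸ r))
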